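{- For every integer $k\ge6$, there exist infinite words that are aperiodic and recurrent and avoid $(k,k-5)$-anti-powers.
   Context: A factor of a word is a contiguous subword; a word avoids a class of words if none of its factors belongs to the class. A $(k,\lambda)$-anti-power is a word $w=w_1w_2\cdots w_k$ with $|w_1|=\cdots=|w_k|$ such that for each fixed $j\in\{1,\dots,k\}$, $|\{i:w_i=w_j\}|\le\lambda$. An infinite word is recurrent if every finite factor occurs infinitely many times. An infinite word $x$ is eventually periodic if some suffix of $x$ equals $u^\omega$ for a finite word $u$; otherwise it is aperiodic. -}

module Defs where

open import Data.Nat using (ℕ; zero; suc; _+_; _*_; _≤_; _≥_)
open import Data.Fin using (Fin; toℕ)
import Data.Fin as Fin
open import Data.List using (List; map; upTo; filter; length; allFin)
open import Data.List.Properties using (≡-dec)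
open import Data.Product using (Σ; ∃; _×_)
open import Relation.Nullary using (¬_)
open import Relation.Binary.PropositionalEquality using (_≡_)

Word : ℕ → Set
Word a = ℕ → Fin a

factor : ∀ {a} → Word a → ℕ → ℕ → List (Fin a)
factor x i m = map (λ t → x (i + t)) (upTo m)

block : ∀ {a} → Word a → ℕ → ℕ → ℕ → List (Fin a)
block x i m j = factor x (i + j * m) m

multiplicity : ∀ {a} → Word a → ℕ → ℕ → (k : ℕ) → Fin k → ℕ
multiplicity {a} x i m k j =
  length (filter (λ j' → ≡-dec Fin._≟_ (block x i m (toℕ j')) (block x i m (toℕ j)))
                 (allFin k))

IsAntiPowerAt : ∀ {a} → Word a → (k λ' : ℕ) → ℕ → ℕ → Set
IsAntiPowerAt x k λ' i m = (j : Fin k) → multiplicity x i m k j ≤ λ'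

AvoidsAntiPowers : ∀ {a} → Word a → (k λ' : ℕ) → Set
AvoidsAntiPowers x k λ' = ¬ (Σ ℕ λ i → Σ ℕ λ m → IsAntiPowerAt x k λ' i m)

Recurrent : ∀ {a} → Word a → Set
Recurrent x = (i m N : ℕ) → Σ ℕ λ i' → (i' ≥ N) × (factor x i' m ≡ factor x i m)

EventuallyPeriodic : ∀ {a} → Word a → Set
EventuallyPeriodic x = Σ ℕ λ s → Σ ℕ λ p → (t : ℕ) → s ≤ t → x (t + suc p) ≡ x t

Aperiodic : ∀ {a} → Word a → Set
Aperiodic x = ¬ EventuallyPeriodic x

-- Let c = 2k + 3 and let x be the characteristic word of the set S of numbers whose base-c
-- digits are all 0 or 1. It is recurrent because S ∩ [c^M, 2c^M) is S ∩ [0, c^M) shifted by c^M,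
-- and aperiodic because a period q would carry c^(M+1) ∈ S to a point of [2c^M, 3c^M), whose
-- digit at position M is 2.
-- Given a factor of length km cut into k blocks, pick L with c^L ≤ (c − 1)m < c^(L+1). The factor
-- is shorter than (c − 2)c^L, so all its elements of S share their digits above position L; their
-- digit at position L is 0 or 1, and each lies less than m above a multiple of c^L because its lower
-- digits are at most 1. So at most four blocks meet S, and the at least k − 4 others are all zero,
-- hence equal, exceeding the allowed multiplicity k − 5.
module Submission where

open import Defs
open import Data.Bool using (Bool; true; false; T; _∧_; _∨_; if_then_else_)
open import Data.Bool.Properties using (T-∧; T?)
open import Data.Empty using (⊥-elim)
open import Data.Fin as Fin using (Fin; toℕ)
open import Data.Fin.Properties using (toℕ<n) renaming (0≢1+n to 0F≢1+n)
open import Data.List using (List; []; _∷_; length; filter; tabulate; allFin)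
open import Data.List.Membership.Propositional using (_∈_)
open import Data.List.Relation.Unary.Any using (here; there)
open import Data.List.Membership.Propositional.Properties using (∈-upTo⁻)
open import Data.List.Properties using (map-cong-local; ≡-dec)
open import Data.List.Relation.Binary.Sublist.Propositional using (⊆-refl)
open import Data.List.Relation.Binary.Sublist.Propositional.Properties using (filter⁺; length-mono-≤)
import Data.List.Relation.Unary.All as All
open import Data.Nat
open import Data.Nat.DivMod
open import Data.Nat.Divisibility using (m∣m*n; n∣m*n; ∣-refl)
open import Data.Nat.Tactic.RingSolver using (solve-∀)
open import Data.Nat.Properties
open import Data.List.Membership.DecPropositional _≟_ using (_∈?_)
open import Data.Product using (Σ; ∃; _×_; _,_; proj₁; proj₂)
open import Data.Sum using (_⊎_; inj₁; inj₂)
open import Function using (_∘_; id; Equivalence)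
open import Level using (0ℓ)
open import Relation.Nullary using (¬_; yes; no; does)
open import Relation.Nullary.Decidable using (fromWitness; isYes≗does)
open import Relation.Unary using (Pred; Decidable)
open import Relation.Binary.PropositionalEquality

factor-cong : ∀ {a} (x y : Word a) i j m →
              (∀ {t} → t < m → x (i + t) ≡ y (j + t)) → factor x i m ≡ factor y j m
factor-cong x y i j m h = map-cong-local (All.tabulate (h ∘ ∈-upTo⁻))

count : (ℕ → Bool) → ℕ → ℕ
count R zero    = 0
count R (suc n) = if R 0 then suc (count (R ∘ suc) n) else count (R ∘ suc) n

count-false : ∀ n → count (λ _ → false) n ≡ 0
count-false zero    = refl
count-false (suc n) = count-false n

count-≡ᵇ : ∀ a n → count (_≡ᵇ a) n ≤ 1
count-≡ᵇ a       zero    = z≤n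
count-≡ᵇ zero    (suc n) = ≤-reflexive (cong suc (count-false n))
count-≡ᵇ (suc a) (suc n) = count-≡ᵇ a n

count-∨ : ∀ R Q n → count (λ t → R t ∨ Q t) n ≤ count R n + count Q n
count-∨ R Q zero = z≤n
count-∨ R Q (suc n) with R 0 | Q 0 | count-∨ (R ∘ suc) (Q ∘ suc) n
... | true  | true  | ih = s≤s (≤-trans ih (+-monoʳ-≤ (count (R ∘ suc) n) (n≤1+n _)))
... | true  | false | ih = s≤s ih
... | false | true  | ih = ≤-trans (s≤s ih) (≤-reflexive (sym (+-suc _ _)))
... | false | false | ih = ih

count-∈ : ∀ ns n → count (λ t → does (t ∈? ns)) n ≤ length ns
count-∈ []       n = ≤-reflexive (count-false n)
count-∈ (a ∷ ns) n = ≤-trans (count-∨ (_≡ᵇ a) (λ t → does (t ∈? ns)) n)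
                             (+-mono-≤ (count-≡ᵇ a n) (count-∈ ns n))

module _ {A : Set} {P : Pred A 0ℓ} (P? : Decidable P) where

  length-filter-tabulate : ∀ {n} (R : ℕ → Bool) (f : Fin n → A) →
                           (∀ j → ¬ P (f j) → T (R (toℕ j))) →
                           n ≤ length (filter P? (tabulate f)) + count R n
  length-filter-tabulate {zero}  R f h = z≤n
  length-filter-tabulate {suc n} R f h
    with P? (f Fin.zero) | R 0 in R0 | length-filter-tabulate (R ∘ suc) (f ∘ Fin.suc) (h ∘ Fin.suc)
  ... | yes _  | true  | ih = s≤s (≤-trans ih (+-monoʳ-≤ _ (n≤1+n _)))
  ... | yes _  | false | ih = s≤s ih
  ... | no  _  | true  | ih = ≤-trans (s≤s ih) (≤-reflexive (sym (+-suc _ _)))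
  ... | no ¬p  | false | ih = ⊥-elim (subst T R0 (h Fin.zero ¬p))

  filter-nonempty : ∀ xs → 0 < length (filter P? xs) → ∃ P
  filter-nonempty (x ∷ xs) pos with P? x
  ... | yes p = x , p
  ... | no _  = filter-nonempty xs pos

length-filter-allFin : ∀ {n} {P : Pred (Fin n) 0ℓ} (P? : Decidable P) ns →
                       (∀ j → ¬ P j → toℕ j ∈ ns) →
                       n ≤ length (filter P? (allFin n)) + length ns
length-filter-allFin {n} {P} P? ns h =
  ≤-trans (length-filter-tabulate P? (λ t → does (t ∈? ns)) id ¬P⇒∈)
          (+-monoʳ-≤ _ (count-∈ ns n))
  where
  ¬P⇒∈ : ∀ j → ¬ P j → T (does (toℕ j ∈? ns))
  ¬P⇒∈ j ¬p = subst T (isYes≗does (toℕ j ∈? ns)) (fromWitness (h j ¬p))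

length-filter-mono : ∀ {A : Set} {P Q : Pred A 0ℓ} (P? : Decidable P) (Q? : Decidable Q) →
                     (∀ {x} → P x → Q x) → ∀ xs → length (filter P? xs) ≤ length (filter Q? xs)
length-filter-mono P? Q? P⇒Q xs = length-mono-≤ (filter⁺ P? Q? (λ { refl → P⇒Q }) (⊆-refl {x = xs}))

/-of-interval : ∀ {a u m} .{{_ : NonZero m}} → a ≤ u → u < a + m →
                u / m ≡ a / m ⊎ u / m ≡ suc (a / m)
/-of-interval {a} {u} {m} a≤u u<a+m with m≤n⇒m<n∨m≡n (/-monoˡ-≤ m a≤u)
... | inj₂ a/m≡u/m = inj₁ (sym a/m≡u/m)
... | inj₁ a/m<u/m = inj₂ (≤-antisym u/m≤1+a/m a/m<u/m)
  where
  u/m≤1+a/m : u / m ≤ suc (a / m)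
  u/m≤1+a/m = begin
    u / m         ≤⟨ /-monoˡ-≤ m (<⇒≤ u<a+m) ⟩
    (a + m) / m   ≡⟨ +-distrib-/-∣ʳ a ∣-refl ⟩
    a / m + m / m ≡⟨ cong (a / m +_) (n/n≡1 m) ⟩
    a / m + 1     ≡⟨ +-comm (a / m) 1 ⟩
    suc (a / m)   ∎
    where open ≤-Reasoning

[j*m+t]/m≡j : ∀ j {m t} .{{_ : NonZero m}} → t < m → (j * m + t) / m ≡ j
[j*m+t]/m≡j j {m} {t} t<m = begin
  (j * m + t) / m   ≡⟨ +-distrib-/-∣ˡ t (n∣m*n j) ⟩
  j * m / m + t / m ≡⟨ cong₂ _+_ (m*n/n≡m j m) (m<n⇒m/n≡0 t<m) ⟩
  j + 0             ≡⟨ +-identityʳ j ⟩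
  j                 ∎
  where open ≡-Reasoning

-- The base is c = 3 + r so that c − 1 = 2 + r and c − 2 = 1 + r need no truncated subtraction.
module ZeroOneDigits (r : ℕ) where

  c : ℕ
  c = 3 + r

  c^≢0 : ∀ L → NonZero (c ^ L)
  c^≢0 L = m^n≢0 c L

  infixl 7 _/c^_
  _/c^_ : ℕ → ℕ → ℕ
  s /c^ L = (s / c ^ L) {{c^≢0 L}}

  digits01-within : ℕ → ℕ → Bool
  digits01-within zero       t = true
  digits01-within (suc fuel) t = (t % c <ᵇ 2) ∧ digits01-within fuel (t / c)

  -- The fuel t suffices because t has at most t base-c digits.
  digits01 : ℕ → Bool
  digits01 t = digits01-within t t

  Digits01 : Pred ℕ 0ℓ
  Digits01 = T ∘ digits01

  digits01-within-0 : ∀ fuel → digits01-within fuel 0 ≡ true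
  digits01-within-0 zero       = refl
  digits01-within-0 (suc fuel) = digits01-within-0 fuel

  /c-≤ : ∀ {t fuel} → t ≤ suc fuel → t / c ≤ fuel
  /c-≤ {zero}  _    = z≤n
  /c-≤ {suc t} t≤1+f = s≤s⁻¹ (≤-trans (m/n<m (suc t) c (s≤s (s≤s z≤n))) t≤1+f)

  digits01-within-enough : ∀ f g {t} → t ≤ f → t ≤ g → digits01-within f t ≡ digits01-within g t
  digits01-within-enough zero    zero    _   _   = refl
  digits01-within-enough zero    (suc g) z≤n _   = sym (digits01-within-0 g)
  digits01-within-enough (suc f) zero    _   z≤n = digits01-within-0 f
  digits01-within-enough (suc f) (suc g) {t} t≤f t≤g =
    cong ((t % c <ᵇ 2) ∧_) (digits01-within-enough f g (/c-≤ t≤f) (/c-≤ t≤g))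

  digits01-unfold : ∀ t → digits01 t ≡ (t % c <ᵇ 2) ∧ digits01 (t / c)
  digits01-unfold zero    = refl
  digits01-unfold (suc t) =
    cong ((suc t % c <ᵇ 2) ∧_) (digits01-within-enough t (suc t / c) (/c-≤ ≤-refl) ≤-refl)

  digits01-split : ∀ s → Digits01 s → T (s % c <ᵇ 2) × Digits01 (s / c)
  digits01-split s h = Equivalence.to (T-∧ {s % c <ᵇ 2}) (subst T (digits01-unfold s) h)

  digits01-%c : ∀ s → Digits01 s → s % c ≤ 1
  digits01-%c s h = s≤s⁻¹ (<ᵇ⇒< (s % c) 2 (proj₁ (digits01-split s h)))

  digits01-/c : ∀ s → Digits01 s → Digits01 (s / c)
  digits01-/c s h = proj₂ (digits01-split s h)

  /c^-suc : ∀ s L → s /c^ suc L ≡ s / c /c^ L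
  /c^-suc s L = sym (m/n/o≡m/[n*o] s c (c ^ L) {{_}} {{c^≢0 L}} {{c^≢0 (suc L)}})

  digits01-/c^ : ∀ L s → Digits01 s → Digits01 (s /c^ L)
  digits01-/c^ zero    s h = subst Digits01 (sym (n/1≡n s)) h
  digits01-/c^ (suc L) s h = subst Digits01 (sym (/c^-suc s L)) (digits01-/c^ L (s / c) (digits01-/c s h))

  digits01-*c : ∀ t → digits01 (t * c) ≡ digits01 t
  digits01-*c t = begin
    digits01 (t * c)                        ≡⟨ digits01-unfold (t * c) ⟩
    (t * c % c <ᵇ 2) ∧ digits01 (t * c / c) ≡⟨ cong₂ (λ a b → (a <ᵇ 2) ∧ digits01 b)
                                                     (m*n%n≡0 t c) (m*n/n≡m t c) ⟩
    digits01 t                              ∎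
    where open ≡-Reasoning

  digits01-c^ : ∀ L → Digits01 (c ^ L)
  digits01-c^ zero    = _
  digits01-c^ (suc L) = subst T (sym (trans (cong digits01 (*-comm c (c ^ L))) (digits01-*c (c ^ L))))
                                (digits01-c^ L)

  ¬digits01-2 : ¬ Digits01 2
  ¬digits01-2 ()

  digits01-c^+ : ∀ M {t} → t < c ^ M → digits01 (c ^ M + t) ≡ digits01 t
  digits01-c^+ zero    {zero}  _        = refl
  digits01-c^+ zero    {suc _} (s≤s ())
  digits01-c^+ (suc M) {t}     t<c^1+M = begin
    digits01 (c * c ^ M + t)
      ≡⟨ digits01-unfold (c * c ^ M + t) ⟩
    ((c * c ^ M + t) % c <ᵇ 2) ∧ digits01 ((c * c ^ M + t) / c)
      ≡⟨ cong₂ (λ a b → (a <ᵇ 2) ∧ digits01 b) low high ⟩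
    (t % c <ᵇ 2) ∧ digits01 (c ^ M + t / c)
      ≡⟨ cong ((t % c <ᵇ 2) ∧_) (digits01-c^+ M t/c<c^M) ⟩
    (t % c <ᵇ 2) ∧ digits01 (t / c)
      ≡⟨ digits01-unfold t ⟨
    digits01 t
      ∎
    where
    open ≡-Reasoning
    low : (c * c ^ M + t) % c ≡ t % c
    low = %-remove-+ˡ t (m∣m*n (c ^ M))
    high : (c * c ^ M + t) / c ≡ c ^ M + t / c
    high = trans (+-distrib-/-∣ˡ t (m∣m*n (c ^ M)))
                 (cong (_+ t / c) (trans (cong (_/ c) (*-comm c (c ^ M))) (m*n/n≡m (c ^ M) c)))
    t/c<c^M : t / c < c ^ M
    t/c<c^M = m<n*o⇒m/o<n (subst (t <_) (*-comm c (c ^ M)) t<c^1+M)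

  -- The digits of s below position L are at most 1, so s mod c^L ≤ (c^L − 1)/(c − 1).
  digits01-remainder-bound : ∀ L s → Digits01 s → (2 + r) * s < (2 + r) * (s /c^ L * c ^ L) + c ^ L
  digits01-remainder-bound zero    s h rewrite n/1≡n s | *-identityʳ s = m<m+n ((2 + r) * s) (s≤s z≤n)
  digits01-remainder-bound (suc L) s h = begin-strict
      d * s                          ≡⟨ cong (d *_) (m≡m%n+[m/n]*n s c) ⟩
      d * (s % c + s₁ * c)           ≤⟨ *-monoʳ-≤ d (+-monoˡ-≤ (s₁ * c) (digits01-%c s h)) ⟩
      d * (1 + s₁ * c)               <⟨ ≤-reflexive (step d s₁) ⟩
      c * (d * s₁ + 1)               ≤⟨ *-monoʳ-≤ c (subst (_≤ bound) (+-comm 1 (d * s₁)) ih) ⟩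
      c * (d * (q * C) + C)          ≡⟨ rescale d q C ⟩
      d * (q * (c * C)) + c * C      ≡⟨ cong (λ z → d * (z * (c * C)) + c * C) (/c^-suc s L) ⟨
      d * (s /c^ suc L * c ^ suc L) + c ^ suc L ∎
    where
    open ≤-Reasoning
    d = 2 + r
    s₁ = s / c
    C = c ^ L
    q = s₁ /c^ L
    bound = d * (q * C) + C
    ih : d * s₁ < bound
    ih = digits01-remainder-bound L s₁ (digits01-/c s h)
    step : ∀ d s₁ → suc (d * (1 + s₁ * suc d)) ≡ suc d * (d * s₁ + 1)
    step = solve-∀
    rescale : ∀ d q C → suc d * (d * (q * C) + C) ≡ d * (q * (suc d * C)) + suc d * C
    rescale = solve-∀

  digits01-close-to-multiple : ∀ L {m} s → c ^ L ≤ (2 + r) * m → Digits01 s → s < s /c^ L * c ^ L + m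
  digits01-close-to-multiple L {m} s C≤dm h = *-cancelˡ-< (2 + r) s (A + m) (begin-strict
    (2 + r) * s               <⟨ digits01-remainder-bound L s h ⟩
    (2 + r) * A + c ^ L       ≤⟨ +-monoʳ-≤ ((2 + r) * A) C≤dm ⟩
    (2 + r) * A + (2 + r) * m ≡⟨ *-distribˡ-+ (2 + r) A m ⟨
    (2 + r) * (A + m)         ∎)
    where
    open ≤-Reasoning
    A = s /c^ L * c ^ L

  n<c^n : ∀ n → n < c ^ n
  n<c^n zero    = s≤s z≤n
  n<c^n (suc n) = subst (_≤ c ^ suc n) (+-comm (suc n) 1)
                        (+-mono-≤ (n<c^n n) (*-mono-≤ (s≤s (z≤n {1 + r})) (m^n>0 c n)))

  c^-bracket : ∀ {y} → 0 < y → ∃ λ L → c ^ L ≤ y × y < c ^ suc L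
  c^-bracket {y} 0<y = search y (n<c^n y)
    where
    search : ∀ f → y < c ^ f → ∃ λ L → c ^ L ≤ y × y < c ^ suc L
    search zero    y<1 = ⊥-elim (<⇒≱ y<1 0<y)
    search (suc f) y<c^1+f with y <? c ^ f
    ... | yes y<c^f = search f y<c^f
    ... | no  y≮c^f = f , ≮⇒≥ y≮c^f , y<c^1+f

  c^-scale : ∀ m .{{_ : NonZero m}} → ∃ λ L → c ^ L ≤ (2 + r) * m × m < c ^ L + c ^ L
  c^-scale m with c^-bracket (≤-trans (>-nonZero⁻¹ m) (m≤n*m m (2 + r)))
  ... | L , C≤dm , dm<cC = L , C≤dm , *-cancelˡ-< (2 + r) m (C + C) (begin-strict
    (2 + r) * m               <⟨ dm<cC ⟩
    C + (2 + r) * C           ≤⟨ +-monoˡ-≤ ((2 + r) * C) (m≤n*m C (2 + r)) ⟩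
    (2 + r) * C + (2 + r) * C ≡⟨ *-distribˡ-+ (2 + r) C C ⟨
    (2 + r) * (C + C)         ∎)
    where
    open ≤-Reasoning
    C = c ^ L

  -- If the digits above position L differed, s' /c^ L would exceed s /c^ L by at least c − 1,
  -- since the digit of s at position L is at most 1.
  digits01-close⇒same-high-digits : ∀ L {s s'} → s ≤ s' → s' < s + (1 + r) * c ^ L →
                                     Digits01 s → s /c^ L / c ≡ s' /c^ L / c
  digits01-close⇒same-high-digits L {s} {s'} s≤s' s'<s+eC hs
    with m≤n⇒m<n∨m≡n (/-monoˡ-≤ c (/-monoˡ-≤ (c ^ L) {{c^≢0 L}} s≤s'))
  ... | inj₂ β≡β' = β≡β'
  ... | inj₁ β<β' = ⊥-elim (<-irrefl refl s'<s')
    where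
    open ≤-Reasoning
    instance _ = c^≢0 L
    C = c ^ L
    q = s /c^ L
    q' = s' /c^ L
    q≤1+βc : q ≤ suc (q / c * c)
    q≤1+βc = begin
      q                 ≡⟨ m≡m%n+[m/n]*n q c ⟩
      q % c + q / c * c ≤⟨ +-monoˡ-≤ (q / c * c) (digits01-%c q (digits01-/c^ L s hs)) ⟩
      suc (q / c * c)   ∎
    q+d≤q' : q + (2 + r) ≤ q'
    q+d≤q' = begin
      q + (2 + r)             ≤⟨ +-monoˡ-≤ (2 + r) q≤1+βc ⟩
      suc (q / c * c) + (2 + r) ≡⟨ cong suc (+-comm (q / c * c) (2 + r)) ⟩
      suc (q / c) * c         ≤⟨ *-monoˡ-≤ c β<β' ⟩
      q' / c * c              ≤⟨ m/n*n≤m q' c ⟩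
      q'                      ∎
    s'<s' : s' < s'
    s'<s' = begin-strict
      s'                        <⟨ s'<s+eC ⟩
      s + (1 + r) * C           ≡⟨ cong (_+ (1 + r) * C) (m≡m%n+[m/n]*n s C) ⟩
      s % C + q * C + (1 + r) * C <⟨ +-monoˡ-< ((1 + r) * C) (+-monoˡ-< (q * C) (m%n<n s C)) ⟩
      C + q * C + (1 + r) * C   ≡⟨ regroup C q r ⟩
      (q + (2 + r)) * C         ≤⟨ *-monoˡ-≤ C q+d≤q' ⟩
      q' * C                    ≤⟨ m/n*n≤m s' C ⟩
      s'                        ∎
      where
      regroup : ∀ C q r → C + q * C + (1 + r) * C ≡ (q + (2 + r)) * C
      regroup = solve-∀

  digits01-window⇒same-high-digits : ∀ L {w s s'} →
    w ≤ s → s < w + (1 + r) * c ^ L → w ≤ s' → s' < w + (1 + r) * c ^ L →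
    Digits01 s → Digits01 s' → s /c^ L / c ≡ s' /c^ L / c
  digits01-window⇒same-high-digits L w≤s s<w+eC w≤s' s'<w+eC hs hs' with ≤-total _ _
  ... | inj₁ s≤s' =
    digits01-close⇒same-high-digits L s≤s' (<-≤-trans s'<w+eC (+-monoˡ-≤ _ w≤s)) hs
  ... | inj₂ s'≤s =
    sym (digits01-close⇒same-high-digits L s'≤s (<-≤-trans s<w+eC (+-monoˡ-≤ _ w≤s')) hs')

  digits01-last-digit : ∀ q → Digits01 q → q ≡ q / c * c ⊎ q ≡ suc (q / c * c)
  digits01-last-digit q h with q % c | digits01-%c q h | m≡m%n+[m/n]*n q c
  ... | 0           | _      | q≡ = inj₁ q≡
  ... | 1           | _      | q≡ = inj₂ q≡
  ... | suc (suc _) | s≤s () | _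

period-multiple : ∀ {a} (x : Word a) {s q} → (∀ t → s ≤ t → x (t + q) ≡ x t) →
                  ∀ j {t} → s ≤ t → x (t + j * q) ≡ x t
period-multiple x         h zero    {t} _   = cong x (+-identityʳ t)
period-multiple x {s} {q} h (suc j) {t} s≤t = begin
  x (t + (q + j * q)) ≡⟨ cong x (regroup t q j) ⟩
  x (t + j * q + q)   ≡⟨ h (t + j * q) (≤-trans s≤t (m≤m+n t (j * q))) ⟩
  x (t + j * q)       ≡⟨ period-multiple x h j s≤t ⟩
  x t                 ∎
  where
  open ≡-Reasoning
  regroup : ∀ t q j → t + (q + j * q) ≡ t + j * q + q
  regroup = solve-∀

module AntiPowerFree (k : ℕ) where

  r : ℕ
  r = k + k

  open ZeroOneDigits r

  x : Word 2
  x t = if digits01 t then Fin.suc Fin.zero else Fin.zero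

  x-cong : ∀ a b → digits01 a ≡ digits01 b → x a ≡ x b
  x-cong a b eq = cong (λ b → if b then Fin.suc Fin.zero else Fin.zero) eq

  x-injective : ∀ a b → x a ≡ x b → digits01 a ≡ digits01 b
  x-injective a b eq with digits01 a | digits01 b
  ... | true  | true  = refl
  ... | false | false = refl
  ... | true  | false = ⊥-elim (0F≢1+n (sym eq))
  ... | false | true  = ⊥-elim (0F≢1+n eq)

  x-unmarked : ∀ t → ¬ Digits01 t → x t ≡ Fin.zero
  x-unmarked t ¬h with digits01 t
  ... | true  = ⊥-elim (¬h _)
  ... | false = refl

  recurrent : Recurrent x
  recurrent i m N = c ^ M + i , N≤c^M+i , factor-cong x x (c ^ M + i) i m shift
    where
    M = N + (i + m)
    N≤c^M+i : N ≤ c ^ M + i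
    N≤c^M+i = ≤-trans (≤-trans (m≤m+n N (i + m)) (<⇒≤ (n<c^n M))) (m≤m+n (c ^ M) i)
    shift : ∀ {t} → t < m → x (c ^ M + i + t) ≡ x (i + t)
    shift {t} t<m = trans (cong x (+-assoc (c ^ M) i t))
                          (x-cong (c ^ M + (i + t)) (i + t) (digits01-c^+ M i+t<c^M))
      where
      i+t<c^M : i + t < c ^ M
      i+t<c^M = <-≤-trans (+-monoʳ-< i t<m) (≤-trans (m≤n+m (i + m) N) (<⇒≤ (n<c^n M)))

  -- t₀ ≥ s is congruent to c^(M+1) modulo q, and its digit at position M is 2.
  aperiodic : Aperiodic x
  aperiodic (s , p , periodic) = ¬digits01-2 (subst Digits01 t₀/C≡2 (digits01-/c^ M t₀ t₀-marked))
    where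
    q = suc p
    M = s + q
    instance _ = c^≢0 M
    C = c ^ M
    D = (1 + r) * C
    t₀ = 2 * C + D % q
    D%q<C : D % q < C
    D%q<C = <-≤-trans (m%n<n D q) (≤-trans (m≤n+m q s) (<⇒≤ (n<c^n M)))
    t₀-reaches-c^[1+M] : t₀ + D / q * q ≡ c ^ suc M
    t₀-reaches-c^[1+M] = begin
      2 * C + D % q + D / q * q   ≡⟨ +-assoc (2 * C) (D % q) (D / q * q) ⟩
      2 * C + (D % q + D / q * q) ≡⟨ cong (2 * C +_) (m≡m%n+[m/n]*n D q) ⟨
      2 * C + (1 + r) * C         ≡⟨ sum-of-coefficients r C ⟩
      c * C                       ∎
      where
      open ≡-Reasoning
      sum-of-coefficients : ∀ r C → 2 * C + (1 + r) * C ≡ (3 + r) * C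
      sum-of-coefficients = solve-∀
    s≤t₀ : s ≤ t₀
    s≤t₀ = begin
      s             ≤⟨ m≤m+n s q ⟩
      M             ≤⟨ <⇒≤ (n<c^n M) ⟩
      C             ≤⟨ m≤n*m C 2 ⟩
      2 * C         ≤⟨ m≤m+n (2 * C) (D % q) ⟩
      t₀            ∎
      where open ≤-Reasoning
    t₀-marked : Digits01 t₀
    t₀-marked = subst T (x-injective (c ^ suc M) t₀ x-c^[1+M]≡x-t₀) (digits01-c^ (suc M))
      where
      x-c^[1+M]≡x-t₀ : x (c ^ suc M) ≡ x t₀
      x-c^[1+M]≡x-t₀ = trans (cong x (sym t₀-reaches-c^[1+M])) (period-multiple x periodic (D / q) s≤t₀)
    t₀/C≡2 : t₀ /c^ M ≡ 2
    t₀/C≡2 = begin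
      (2 * C + D % q) / C      ≡⟨ +-distrib-/-∣ˡ (D % q) (n∣m*n 2) ⟩
      2 * C / C + D % q / C    ≡⟨ cong₂ _+_ (m*n/n≡m 2 C) (m<n⇒m/n≡0 D%q<C) ⟩
      2                        ∎
      where open ≡-Reasoning

  zeros : ℕ → List (Fin 2)
  zeros = factor (λ _ → Fin.zero) 0

  nonzero-block⇒marked : ∀ i m j → block x i m j ≢ zeros m →
                         ∃ λ t → t < m × Digits01 (i + (j * m + t))
  nonzero-block⇒marked i m j nonzero with anyUpTo? (λ t → T? (digits01 (i + (j * m + t)))) m
  ... | yes found = found
  ... | no  none  = ⊥-elim (nonzero (factor-cong x (λ _ → Fin.zero) (i + j * m) 0 m unmarked))
    where
    unmarked : ∀ {t} → t < m → x (i + j * m + t) ≡ Fin.zero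
    unmarked {t} t<m = x-unmarked (i + j * m + t)
                         (λ h → none (t , t<m , subst Digits01 (+-assoc i (j * m) t) h))

  marked-offsets-meet-four-blocks :
    ∀ i m .{{_ : NonZero m}} {u₀} → u₀ < k * m → Digits01 (i + u₀) →
    ∃ λ ns → length ns ≤ 4 × (∀ {u} → u < k * m → Digits01 (i + u) → u / m ∈ ns)
  marked-offsets-meet-four-blocks i m {u₀} u₀<km h₀ with c^-scale m
  ... | L , C≤dm , m<2C = candidates , ≤-refl , hit
    where
    open ≤-Reasoning
    C = c ^ L
    instance _ = c^≢0 L
    km≤eC : k * m ≤ (1 + r) * C
    km≤eC = begin
      k * m         ≤⟨ *-monoʳ-≤ k (<⇒≤ m<2C) ⟩
      k * (C + C)   ≡⟨ double k C ⟩
      (k + k) * C   ≤⟨ m≤n+m ((k + k) * C) C ⟩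
      (1 + r) * C   ∎
      where
      double : ∀ k C → k * (C + C) ≡ (k + k) * C
      double = solve-∀
    in-window : ∀ {u} → u < k * m → i + u < i + (1 + r) * C
    in-window u<km = +-monoʳ-< i (<-≤-trans u<km km≤eC)
    β = (i + u₀) /c^ L / c
    blockOf : ℕ → ℕ
    blockOf q = (q * C ∸ i) / m
    candidates : List ℕ
    candidates = blockOf (β * c) ∷ suc (blockOf (β * c)) ∷
                 blockOf (suc (β * c)) ∷ suc (blockOf (suc (β * c))) ∷ []
    hit : ∀ {u} → u < k * m → Digits01 (i + u) → u / m ∈ candidates
    hit {u} u<km hu = place q≡βc⊎q≡1+βc (/-of-interval A∸i≤u u<A∸i+m)
      where
      q = (i + u) /c^ L
      A = q * C
      q≡βc⊎q≡1+βc : q ≡ β * c ⊎ q ≡ suc (β * c)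
      q≡βc⊎q≡1+βc = subst (λ b → q ≡ b * c ⊎ q ≡ suc (b * c))
        (digits01-window⇒same-high-digits L (m≤m+n i u) (in-window u<km)
                                            (m≤m+n i u₀) (in-window u₀<km) hu h₀)
        (digits01-last-digit q (digits01-/c^ L (i + u) hu))
      A∸i≤u : A ∸ i ≤ u
      A∸i≤u = subst (A ∸ i ≤_) (m+n∸m≡n i u) (∸-monoˡ-≤ i (m/n*n≤m (i + u) C))
      u<A∸i+m : u < A ∸ i + m
      u<A∸i+m = +-cancelˡ-< i u (A ∸ i + m) (begin-strict
        i + u           <⟨ digits01-close-to-multiple L (i + u) C≤dm hu ⟩
        A + m           ≤⟨ +-monoˡ-≤ m (m≤n+m∸n A i) ⟩
        i + (A ∸ i) + m ≡⟨ +-assoc i (A ∸ i) m ⟩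
        i + (A ∸ i + m) ∎)
      place : q ≡ β * c ⊎ q ≡ suc (β * c) → u / m ≡ blockOf q ⊎ u / m ≡ suc (blockOf q) →
              u / m ∈ candidates
      place (inj₁ q≡) (inj₁ u≡) = here (trans u≡ (cong blockOf q≡))
      place (inj₁ q≡) (inj₂ u≡) = there (here (trans u≡ (cong (suc ∘ blockOf) q≡)))
      place (inj₂ q≡) (inj₁ u≡) = there (there (here (trans u≡ (cong blockOf q≡))))
      place (inj₂ q≡) (inj₂ u≡) = there (there (there (here (trans u≡ (cong (suc ∘ blockOf) q≡)))))

  nonzero-block⇒marked-offset : ∀ i m .{{_ : NonZero m}} (j : Fin k) → block x i m (toℕ j) ≢ zeros m →
                                ∃ λ u → u < k * m × Digits01 (i + u) × u / m ≡ toℕ j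
  nonzero-block⇒marked-offset i m j nonzero with nonzero-block⇒marked i m (toℕ j) nonzero
  ... | t , t<m , ht = toℕ j * m + t , offset<km , ht , [j*m+t]/m≡j (toℕ j) t<m
    where
    offset<km : toℕ j * m + t < k * m
    offset<km = <-≤-trans (+-monoʳ-< (toℕ j * m) t<m)
                          (≤-trans (≤-reflexive (+-comm (toℕ j * m) m)) (*-monoˡ-≤ m (toℕ<n j)))

  nonzero-blocks-among-four : ∀ i m → ∃ λ ns → length ns ≤ 4 ×
                              (∀ (j : Fin k) → block x i m (toℕ j) ≢ zeros m → toℕ j ∈ ns)
  nonzero-blocks-among-four i zero = [] , z≤n , λ _ nonzero → ⊥-elim (nonzero refl)
  nonzero-blocks-among-four i m@(suc _) with anyUpTo? (λ u → T? (digits01 (i + u))) (k * m)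
  ... | no none = [] , z≤n , λ j nonzero →
    let (u , u<km , hu , _) = nonzero-block⇒marked-offset i m j nonzero
    in ⊥-elim (none (u , u<km , hu))
  ... | yes (u₀ , u₀<km , h₀) =
    let (ns , |ns|≤4 , hit) = marked-offsets-meet-four-blocks i m u₀<km h₀ in
    ns , |ns|≤4 , λ j nonzero →
    let (u , u<km , hu , u/m≡j) = nonzero-block⇒marked-offset i m j nonzero
    in subst (_∈ ns) u/m≡j (hit u<km hu)

  avoids : 6 ≤ k → AvoidsAntiPowers x k (k ∸ 5)
  avoids k≥6 (i , m , anti-power) with nonzero-blocks-among-four i m
  ... | ns , |ns|≤4 , nonzero∈ns = <-irrefl refl k<k
    where
    ZeroBlock : Pred (Fin k) 0ℓ
    ZeroBlock j = block x i m (toℕ j) ≡ zeros m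
    ZeroBlock? : Decidable ZeroBlock
    ZeroBlock? j = ≡-dec Fin._≟_ (block x i m (toℕ j)) (zeros m)
    z = length (filter ZeroBlock? (allFin k))
    k≤z+4 : k ≤ z + 4
    k≤z+4 = ≤-trans (length-filter-allFin ZeroBlock? ns nonzero∈ns) (+-monoʳ-≤ z |ns|≤4)
    some-zero : ∃ ZeroBlock
    some-zero = filter-nonempty ZeroBlock? (allFin k)
                  (≤-trans (s≤s z≤n) (+-cancelʳ-≤ 4 2 z (≤-trans k≥6 k≤z+4)))
    j₀ = proj₁ some-zero
    z≤multiplicity : z ≤ multiplicity x i m k j₀
    z≤multiplicity =
      length-filter-mono ZeroBlock? (λ j → ≡-dec Fin._≟_ (block x i m (toℕ j)) (block x i m (toℕ j₀)))
                         (λ zero-j → trans zero-j (sym (proj₂ some-zero))) (allFin k)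
    k<k : k < k
    k<k = begin-strict
      k         ≤⟨ k≤z+4 ⟩
      z + 4     ≤⟨ +-monoˡ-≤ 4 (≤-trans z≤multiplicity (anti-power j₀)) ⟩
      k ∸ 5 + 4 <⟨ +-monoʳ-< (k ∸ 5) (≤-refl {5}) ⟩
      k ∸ 5 + 5 ≡⟨ m∸n+n≡m (≤-trans (n≤1+n 5) k≥6) ⟩
      k         ∎
      where open ≤-Reasoning

theorem4p6 : (k : ℕ) → k ≥ 6 →
    Σ ℕ λ a → Σ (Word a) λ x → Aperiodic x × Recurrent x × AvoidsAntiPowers x k (k ∸ 5)
theorem4p6 k k≥6 = 2 , x , aperiodic , recurrent , avoids k≥6
  where open AntiPowerFree k
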